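{- If $G$ is a JHC-graph satisfying the triangle condition (TC), then $G$ is a graph with convex clique-shadows.
   Context: Graphs are undirected, simple, connected; $d$ is the shortest-path distance, $[u,v]=\{w: d(u,w)+d(w,v)=d(u,v)\}$. A set is convex if it contains $[u,v]$ for any two of its vertices; $\mathrm{conv}(A)$ is the convex hull. $G$ is a JHC-graph (join-hull commutative) if for every convex set $A$ and every vertex $x$, $\mathrm{conv}(A\cup\{x\})=\bigcup_{a\in A}[x,a]$. Triangle condition (TC): for any $u,v,w$ with $1=d(v,w)<d(u,v)=d(u,w)$ there is a common neighbor $x$ of $v,w$ with $d(u,x)=d(u,v)-1$. Shadow: $K/x_0=\{x: \mathrm{conv}(\{x_0,x\})\cap K\neq\varnothing\}$. A pointed maximal clique is a pair $(x_0,K)$ with $K$ a clique, $x_0\notin K$, and $K\cup\{x_0\}$ a maximal clique. $G$ is a graph with convex clique-shadows if $K/x_0$ is convex for every pointed maximal clique $(x_0,K)$. -}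

module Defs where

open import Level using (Level; 0ℓ; _⊔_) renaming (suc to lsuc)
open import Data.Nat using (ℕ; zero; suc; _+_; _∸_; _≤_; _<_)
open import Data.Product using (Σ; ∃; ∃-syntax; _×_; _,_)
open import Relation.Nullary using (¬_)
open import Relation.Binary.PropositionalEquality using (_≡_)
open import Relation.Unary using (Pred; _⊆_; _∪_; ｛_｝; Satisfiable)

data Walk {V : Set} (E : V → V → Set) : V → V → ℕ → Set where
  here : ∀ {u} → Walk E u u zero
  step : ∀ {u w v n} → E u w → Walk E w v n → Walk E u v (suc n)

record Graph : Set₁ where
  field
    V         : Set
    E         : V → V → Set
    irrefl    : ∀ {x} → ¬ E x x
    sym       : ∀ {x y} → E x y → E y x
    connected : ∀ x y → ∃[ n ] Walk E x y n

module _ (G : Graph) where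
  open Graph G

  Dist : V → V → ℕ → Set
  Dist u v n = Walk E u v n × (∀ m → Walk E u v m → n ≤ m)

  Interval : V → V → Pred V 0ℓ
  Interval u v w = ∃[ a ] ∃[ b ] ∃[ n ] (Dist u w a × Dist w v b × Dist u v n × a + b ≡ n)

  Convex : ∀ {ℓ} → Pred V ℓ → Set ℓ
  Convex A = ∀ {u v w} → A u → A v → Interval u v w → A w

  conv : ∀ {ℓ} → Pred V ℓ → Pred V (lsuc ℓ)
  conv {ℓ} A x = (C : Pred V ℓ) → Convex C → A ⊆ C → C x

  JoinUnion : ∀ {ℓ} → V → Pred V ℓ → Pred V ℓ
  JoinUnion x A y = ∃[ a ] (A a × Interval x a y)

  JHC : Set₁
  JHC = (A : Pred V 0ℓ) → Convex A → Satisfiable A → (x : V) →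
        (conv (A ∪ ｛ x ｝) ⊆ JoinUnion x A) × (JoinUnion x A ⊆ conv (A ∪ ｛ x ｝))

  TC : Set
  TC = ∀ {u v w n} → E v w → 1 < n → Dist u v n → Dist u w n →
       ∃[ x ] (E x v × E x w × Dist u x (n ∸ 1))

  IsClique : ∀ {ℓ} → Pred V ℓ → Set ℓ
  IsClique K = ∀ {u v} → K u → K v → ¬ u ≡ v → E u v

  IsMaximalClique : ∀ {ℓ} → Pred V ℓ → Set ℓ
  IsMaximalClique K = IsClique K × (∀ y → (∀ {k} → K k → ¬ y ≡ k → E y k) → K y)

  PointedMaximalClique : Pred V 0ℓ → V → Set
  PointedMaximalClique K x₀ = IsClique K × ¬ K x₀ × IsMaximalClique (K ∪ ｛ x₀ ｝)

  Shadow : Pred V 0ℓ → V → Pred V (lsuc 0ℓ)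
  Shadow K x₀ x = ∃[ k ] (K k × conv (｛ x₀ ｝ ∪ ｛ x ｝) k)

  ConvexCliqueShadows : Set₁
  ConvexCliqueShadows = (K : Pred V 0ℓ) (x₀ : V) → PointedMaximalClique K x₀ → Convex (Shadow K x₀)

{-# OPTIONS --safe #-}
-- Under JHC, conv {x₀, x} = [x, x₀], so (for K adjacent to x₀) the shadow K/x₀ is the set of
-- vertices x with d(x,k) + 1 = d(x,x₀) for some k ∈ K. The triangle condition and the
-- maximality of K ∪ {x₀} show that every convex set containing K but not x₀ lies in K/x₀.
-- For u, v ∈ K/x₀ the hull conv(K ∪ {u}) = ⋃_{k ∈ K} [u,k] avoids x₀, hence lies in K/x₀;
-- then conv(K ∪ {u,v}) = ⋃_{t ∈ conv(K ∪ {u})} [v,t] avoids x₀ too, since x₀ lies on no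
-- geodesic between two points of K/x₀. So it lies in K/x₀, and it contains [u,v].
module Submission where

open import Level using (0ℓ)
open import Function using (id; _∘_)
open import Data.Nat using (ℕ; zero; suc; _+_; _≤_; z≤n; s≤s; _≟_)
open import Data.Nat.Properties
open import Data.Product using (∃-syntax; _×_; _,_; proj₁; proj₂)
open import Data.Sum using (_⊎_; inj₁; inj₂; [_,_]) renaming (map to map-⊎)
open import Data.Empty using (⊥-elim)
open import Relation.Nullary using (¬_; yes; no)
open import Relation.Binary.PropositionalEquality using (_≡_; refl; sym; trans; cong; cong₂; subst; module ≡-Reasoning)
open import Relation.Unary using (Pred; _⊆_; _∪_; ｛_｝; Satisfiable)
open import Defs

m+n≤1⇒m≡0⊎n≡0 : ∀ {m n} → m + n ≤ 1 → m ≡ 0 ⊎ n ≡ 0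
m+n≤1⇒m≡0⊎n≡0 {zero}                  _         = inj₁ refl
m+n≤1⇒m≡0⊎n≡0 {suc m}       {zero}    _         = inj₂ refl
m+n≤1⇒m≡0⊎n≡0 {suc zero}    {suc n}   (s≤s ())
m+n≤1⇒m≡0⊎n≡0 {suc (suc m)} {suc n}   (s≤s ())

m≤1+n⇒n≤1+m⇒m≡n±1 : ∀ {m n} → m ≤ suc n → n ≤ suc m → suc m ≡ n ⊎ m ≡ n ⊎ m ≡ suc n
m≤1+n⇒n≤1+m⇒m≡n±1 {zero}        {zero}        _ _        = inj₂ (inj₁ refl)
m≤1+n⇒n≤1+m⇒m≡n±1 {zero}        {suc zero}    _ _        = inj₁ refl
m≤1+n⇒n≤1+m⇒m≡n±1 {zero}        {suc (suc n)} _ (s≤s ())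
m≤1+n⇒n≤1+m⇒m≡n±1 {suc zero}    {zero}        _ _        = inj₂ (inj₂ refl)
m≤1+n⇒n≤1+m⇒m≡n±1 {suc (suc m)} {zero}        (s≤s ()) _
m≤1+n⇒n≤1+m⇒m≡n±1 {suc m}       {suc n}       p q        =
  map-⊎ (cong suc) (map-⊎ (cong suc) (cong suc)) (m≤1+n⇒n≤1+m⇒m≡n±1 (≤-pred p) (≤-pred q))

module WalkProperties (G : Graph) where
  open Graph G renaming (sym to E-sym)

  _++_ : ∀ {a b c m n} → Walk E a b m → Walk E b c n → Walk E a c (m + n)
  here     ++ q = q
  step e p ++ q = step e (p ++ q)

  snoc : ∀ {a b c n} → Walk E a b n → E b c → Walk E a c (suc n)
  snoc here       e = step e here
  snoc (step f p) e = step f (snoc p e)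

  reverse : ∀ {a b n} → Walk E a b n → Walk E b a n
  reverse here       = here
  reverse (step e p) = snoc (reverse p) (E-sym e)

  Dist-unique : ∀ {a b m n} → Dist G a b m → Dist G a b n → m ≡ n
  Dist-unique (p , p-min) (q , q-min) = ≤-antisym (p-min _ q) (q-min _ p)

  Dist-sym : ∀ {a b n} → Dist G a b n → Dist G b a n
  Dist-sym (p , p-min) = reverse p , λ m q → p-min m (reverse q)

  Dist-refl : ∀ {a} → Dist G a a 0
  Dist-refl = here , λ _ _ → z≤n

  Dist-zero⇒≡ : ∀ {a b} → Dist G a b 0 → a ≡ b
  Dist-zero⇒≡ (here , _) = refl

  E⇒Dist-one : ∀ {a b} → E a b → Dist G a b 1
  E⇒Dist-one e = step e here , λ { zero here → ⊥-elim (irrefl e) ; (suc m) _ → s≤s z≤n }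

  singleton-convex : ∀ a → Convex G ｛ a ｝
  singleton-convex a refl refl (m , _ , l , Dm , _ , Dl , m+n≡l) =
    Dist-zero⇒≡ (subst (Dist G a _) (m+n≡0⇒m≡0 m (trans m+n≡l (Dist-unique Dl Dist-refl))) Dm)

  conv-convex : ∀ {ℓ} (A : Pred V ℓ) → Convex G (conv G A)
  conv-convex A p∈ q∈ I C C-convex A⊆C = C-convex (p∈ C C-convex A⊆C) (q∈ C C-convex A⊆C) I

module JoinHull (G : Graph) (jhc : JHC G) where
  open WalkProperties G

  conv-pair⊆Interval : ∀ {p q} → conv G (｛ p ｝ ∪ ｛ q ｝) ⊆ Interval G q p
  conv-pair⊆Interval {p} {q} r∈ with proj₁ (jhc ｛ p ｝ (singleton-convex p) (p , refl) q) r∈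
  ... | _ , refl , r∈[q,p] = r∈[q,p]

  Interval⊆conv-pair : ∀ {p q} → Interval G q p ⊆ conv G (｛ p ｝ ∪ ｛ q ｝)
  Interval⊆conv-pair {p} {q} r∈[q,p] = proj₂ (jhc ｛ p ｝ (singleton-convex p) (p , refl) q) (p , refl , r∈[q,p])

  -- Connectedness alone gives no shortest walk constructively; JHC does, as p ∈ conv {q, p} = [p, q].
  distance : ∀ p q → ∃[ n ] Dist G p q n
  distance p q with conv-pair⊆Interval {q} {p} (λ _ _ A⊆C → A⊆C (inj₂ refl))
  ... | _ , _ , n , _ , _ , Dpq , _ = n , Dpq

  JoinUnion-convex : ∀ {A x} → Convex G A → Satisfiable A → Convex G (JoinUnion G x A)
  JoinUnion-convex {A} {x} A-convex A≠∅ p∈ q∈ =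
    hull⊆ ∘ conv-convex (A ∪ ｛ x ｝) (⊆hull p∈) (⊆hull q∈)
    where
      hull⊆ = proj₁ (jhc A A-convex A≠∅ x)
      ⊆hull = proj₂ (jhc A A-convex A≠∅ x)

module Metric (G : Graph) (distance : ∀ p q → ∃[ n ] Dist G p q n) where
  open Graph G renaming (sym to E-sym)
  open WalkProperties G

  d : V → V → ℕ
  d p q = proj₁ (distance p q)

  d-Dist : ∀ p q → Dist G p q (d p q)
  d-Dist p q = proj₂ (distance p q)

  Dist⇒d≡ : ∀ {p q n} → Dist G p q n → d p q ≡ n
  Dist⇒d≡ = Dist-unique (d-Dist _ _)

  d≡⇒Dist : ∀ {p q n} → d p q ≡ n → Dist G p q n
  d≡⇒Dist eq = subst (Dist G _ _) eq (d-Dist _ _)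

  d-sym : ∀ p q → d p q ≡ d q p
  d-sym p q = Dist⇒d≡ (Dist-sym (d-Dist q p))

  d-refl : ∀ p → d p p ≡ 0
  d-refl p = Dist⇒d≡ Dist-refl

  ≡⇒d≡0 : ∀ {p q} → p ≡ q → d p q ≡ 0
  ≡⇒d≡0 refl = d-refl _

  d≡0⇒≡ : ∀ {p q} → d p q ≡ 0 → p ≡ q
  d≡0⇒≡ = Dist-zero⇒≡ ∘ d≡⇒Dist

  E⇒d≡1 : ∀ {p q} → E p q → d p q ≡ 1
  E⇒d≡1 = Dist⇒d≡ ∘ E⇒Dist-one

  d≡1⇒E : ∀ {p q} → d p q ≡ 1 → E p q
  d≡1⇒E eq with d≡⇒Dist eq
  ... | step e here , _ = e

  d-triangle : ∀ p q r → d p r ≤ d p q + d q r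
  d-triangle p q r = proj₂ (d-Dist p r) _ (proj₁ (d-Dist p q) ++ proj₁ (d-Dist q r))

  d-neighbour : ∀ {a b} w → E a b → d w a ≤ suc (d w b)
  d-neighbour {a} {b} w e = begin
    d w a         ≤⟨ d-triangle w b a ⟩
    d w b + d b a ≡⟨ cong (d w b +_) (E⇒d≡1 (E-sym e)) ⟩
    d w b + 1     ≡⟨ +-comm (d w b) 1 ⟩
    suc (d w b)   ∎
    where open ≤-Reasoning

  d+edge : ∀ {p q} w → E p q → d w p + d p q ≡ suc (d w p)
  d+edge {p} w e = trans (cong (d w p +_) (E⇒d≡1 e)) (+-comm (d w p) 1)

  Interval⇒d≡ : ∀ {p q r} → Interval G p q r → d p r + d r q ≡ d p q
  Interval⇒d≡ (_ , _ , _ , Da , Db , Dn , a+b≡n)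
    rewrite Dist⇒d≡ Da | Dist⇒d≡ Db | Dist⇒d≡ Dn = a+b≡n

  d≡⇒Interval : ∀ {p q r} → d p r + d r q ≡ d p q → Interval G p q r
  d≡⇒Interval eq = _ , _ , _ , d-Dist _ _ , d-Dist _ _ , d-Dist _ _ , eq

  Interval-sym : ∀ {p q r} → Interval G p q r → Interval G q p r
  Interval-sym {p} {q} {r} r∈[p,q] = d≡⇒Interval (begin
    d q r + d r p ≡⟨ +-comm (d q r) (d r p) ⟩
    d r p + d q r ≡⟨ cong₂ _+_ (d-sym r p) (d-sym q r) ⟩
    d p r + d r q ≡⟨ Interval⇒d≡ r∈[p,q] ⟩
    d p q         ≡⟨ d-sym p q ⟩
    d q p         ∎)
    where open ≡-Reasoning

  Interval-start : ∀ {p q} → Interval G p q p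
  Interval-start {p} {q} = 0 , d p q , d p q , Dist-refl , d-Dist p q , d-Dist p q , refl

  Interval-end : ∀ {p q} → Interval G p q q
  Interval-end {p} {q} = d p q , 0 , d p q , d-Dist p q , Dist-refl , d-Dist p q , +-identityʳ (d p q)

  start∈JoinUnion : ∀ {ℓ} {A : Pred V ℓ} {x} → Satisfiable A → JoinUnion G x A x
  start∈JoinUnion (a , a∈A) = a , a∈A , Interval-start

  ⊆JoinUnion : ∀ {ℓ} {A : Pred V ℓ} {x} → A ⊆ JoinUnion G x A
  ⊆JoinUnion {x = x} {a} a∈A = a , a∈A , Interval-end

  Interval-short : ∀ {p q r} → d p q ≤ 1 → Interval G p q r → p ≡ r ⊎ r ≡ q
  Interval-short {p} {q} {r} pq≤1 r∈[p,q] =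
    map-⊎ d≡0⇒≡ d≡0⇒≡ (m+n≤1⇒m≡0⊎n≡0 (subst (_≤ 1) (sym (Interval⇒d≡ r∈[p,q])) pq≤1))

  clique-d≤1 : ∀ {ℓ} {K : Pred V ℓ} → IsClique G K → ∀ {p q} → K p → K q → d p q ≤ 1
  clique-d≤1 K-clique {p} {q} p∈K q∈K with d p q ≟ 0
  ... | yes pq≡0 = subst (_≤ 1) (sym pq≡0) z≤n
  ... | no  pq≢0 = ≤-reflexive (E⇒d≡1 (K-clique p∈K q∈K (pq≢0 ∘ ≡⇒d≡0)))

  clique-convex : ∀ {ℓ} {K : Pred V ℓ} → IsClique G K → Convex G K
  clique-convex {K = K} K-clique p∈K q∈K r∈[p,q] =
    [ (λ p≡r → subst K p≡r p∈K) , (λ r≡q → subst K (sym r≡q) q∈K) ]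
      (Interval-short (clique-d≤1 K-clique p∈K q∈K) r∈[p,q])

  two-step : ∀ {x y z} → E x y → E y z → ¬ x ≡ z → E x z ⊎ Interval G x z y
  two-step {x} {y} {z} xy yz x≢z with d x z in eq | xz≤2
    where
      xz≤2 : d x z ≤ 2
      xz≤2 = subst (d x z ≤_) (cong₂ _+_ (E⇒d≡1 xy) (E⇒d≡1 yz)) (d-triangle x y z)
  ... | 0                 | _ = ⊥-elim (x≢z (d≡0⇒≡ eq))
  ... | 1                 | _ = inj₁ (d≡1⇒E eq)
  ... | 2                 | _ = inj₂ (d≡⇒Interval (trans (cong₂ _+_ (E⇒d≡1 xy) (E⇒d≡1 yz)) (sym eq)))
  ... | suc (suc (suc _)) | s≤s (s≤s ())

module CliqueShadow (G : Graph) (jhc : JHC G) (tc : TC G) (K : Pred (Graph.V G) 0ℓ) (x₀ : Graph.V G)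
                    (pmc : PointedMaximalClique G K x₀) where
  open Graph G renaming (sym to E-sym)
  open JoinHull G jhc
  open Metric G distance

  K-clique : IsClique G K
  K-clique = proj₁ pmc

  x₀∉K : ¬ K x₀
  x₀∉K = proj₁ (proj₂ pmc)

  K+x₀-maximal : IsMaximalClique G (K ∪ ｛ x₀ ｝)
  K+x₀-maximal = proj₂ (proj₂ pmc)

  K-convex : Convex G K
  K-convex = clique-convex K-clique

  apex-adjacent : ∀ {k} → K k → E x₀ k
  apex-adjacent k∈K = proj₁ K+x₀-maximal (inj₂ refl) (inj₁ k∈K) λ { refl → x₀∉K k∈K }

  MetricShadow : Pred V 0ℓ
  MetricShadow x = ∃[ k ] (K k × suc (d x k) ≡ d x x₀)

  Shadow⇒MetricShadow : Shadow G K x₀ ⊆ MetricShadow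
  Shadow⇒MetricShadow {x} (k , k∈K , k∈conv) =
    k , k∈K , trans (sym (d+edge x (E-sym (apex-adjacent k∈K)))) (Interval⇒d≡ (conv-pair⊆Interval k∈conv))

  MetricShadow⇒Shadow : MetricShadow ⊆ Shadow G K x₀
  MetricShadow⇒Shadow {x} (k , k∈K , eq) =
    k , k∈K , Interval⊆conv-pair (d≡⇒Interval (trans (d+edge x (E-sym (apex-adjacent k∈K))) eq))

  K⊆MetricShadow : K ⊆ MetricShadow
  K⊆MetricShadow {k} k∈K = k , k∈K , trans (cong suc (d-refl k)) (sym (E⇒d≡1 (E-sym (apex-adjacent k∈K))))

  apex∉Interval : ∀ {p q} → MetricShadow p → MetricShadow q → ¬ Interval G p q x₀
  apex∉Interval {p} {q} (kp , kp∈K , p-eq) (kq , kq∈K , q-eq) x₀∈[p,q] = <-irrefl refl (begin-strict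
    d p kp + suc (d q kq)          <⟨ n<1+n _ ⟩
    suc (d p kp) + suc (d q kq)    ≡⟨ cong₂ _+_ p-eq (trans q-eq (d-sym q x₀)) ⟩
    d p x₀ + d x₀ q                ≡⟨ Interval⇒d≡ x₀∈[p,q] ⟩
    d p q                          ≤⟨ d-triangle p kp q ⟩
    d p kp + d kp q                ≤⟨ +-monoʳ-≤ (d p kp) (d-triangle kp kq q) ⟩
    d p kp + (d kp kq + d kq q)    ≤⟨ +-monoʳ-≤ (d p kp) (+-mono-≤ (clique-d≤1 K-clique kp∈K kq∈K)
                                                                   (≤-reflexive (d-sym kq q))) ⟩
    d p kp + suc (d q kq)          ∎)
    where open ≤-Reasoning

  module _ {T : Pred V 0ℓ} (T-convex : Convex G T) (K⊆T : K ⊆ T) (x₀∉T : ¬ T x₀) where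

    apex-neighbour∈K : ∀ {z} → T z → E z x₀ → K z
    apex-neighbour∈K {z} z∈T zx₀ with proj₂ K+x₀-maximal z adjacent
      where
        adjacent : ∀ {k} → (K ∪ ｛ x₀ ｝) k → ¬ z ≡ k → E z k
        adjacent (inj₂ refl) _   = zx₀
        adjacent (inj₁ k∈K)  z≢k =
          [ id , (λ x₀∈[z,k] → ⊥-elim (x₀∉T (T-convex z∈T (K⊆T k∈K) x₀∈[z,k]))) ]
            (two-step zx₀ (apex-adjacent k∈K) z≢k)
    ... | inj₁ z∈K  = z∈K
    ... | inj₂ refl = ⊥-elim (irrefl zx₀)

    equidistant⇒MetricShadow : ∀ {k w} n → K k → T w → d w k ≡ n → d w x₀ ≡ n → MetricShadow w
    equidistant⇒MetricShadow 0 _ w∈T _ wx₀≡0 = ⊥-elim (x₀∉T (subst T (d≡0⇒≡ wx₀≡0) w∈T))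
    equidistant⇒MetricShadow {w = w} 1 _ w∈T _ wx₀≡1 =
      w , apex-neighbour∈K w∈T (d≡1⇒E wx₀≡1) , trans (cong suc (d-refl w)) (sym wx₀≡1)
    equidistant⇒MetricShadow {k} {w} (suc (suc n)) k∈K w∈T wk≡ wx₀≡
      with tc (apex-adjacent k∈K) (s≤s (s≤s z≤n)) (d≡⇒Dist wx₀≡) (d≡⇒Dist wk≡)
    ... | z , zx₀ , zk , Dwz = z , apex-neighbour∈K z∈T zx₀ , trans (cong suc (Dist⇒d≡ Dwz)) (sym wx₀≡)
      where
        z∈T : T z
        z∈T = T-convex w∈T (K⊆T k∈K) (d≡⇒Interval (trans (d+edge w zk) (trans (cong suc (Dist⇒d≡ Dwz)) (sym wk≡))))

    convex⊆MetricShadow : ∀ {k} → K k → T ⊆ MetricShadow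
    convex⊆MetricShadow {k} k∈K {w} w∈T
      with m≤1+n⇒n≤1+m⇒m≡n±1 (d-neighbour w (E-sym (apex-adjacent k∈K))) (d-neighbour w (apex-adjacent k∈K))
    ... | inj₁ closer         = k , k∈K , closer
    ... | inj₂ (inj₁ equal)   = equidistant⇒MetricShadow _ k∈K w∈T equal refl
    ... | inj₂ (inj₂ farther) =
      ⊥-elim (x₀∉T (T-convex w∈T (K⊆T k∈K) (d≡⇒Interval (trans (d+edge w (apex-adjacent k∈K)) (sym farther)))))

  JoinUnion⊆MetricShadow : ∀ {T v} → MetricShadow v → Convex G T → Satisfiable T → K ⊆ T →
                           T ⊆ MetricShadow → JoinUnion G v T ⊆ MetricShadow
  JoinUnion⊆MetricShadow {T} {v} v∈@(_ , k∈K , _) T-convex T≠∅ K⊆T T⊆ =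
    convex⊆MetricShadow (JoinUnion-convex T-convex T≠∅) (⊆JoinUnion ∘ K⊆T) x₀∉ k∈K
    where
      x₀∉ : ¬ JoinUnion G v T x₀
      x₀∉ (t , t∈T , x₀∈[v,t]) = apex∉Interval v∈ (T⊆ t∈T) x₀∈[v,t]

proposition4p7 : (G : Graph) → JHC G → TC G → ConvexCliqueShadows G
proposition4p7 G jhc tc K x₀ pmc {u} {v} u∈ v∈ w∈[u,v] =
  MetricShadow⇒Shadow (hull₂⊆ (u , start∈JoinUnion K≠∅ , Interval-sym w∈[u,v]))
  where
    open JoinHull G jhc
    open Metric G distance
    open CliqueShadow G jhc tc K x₀ pmc

    u∈′ : MetricShadow u
    u∈′ = Shadow⇒MetricShadow u∈

    K≠∅ : Satisfiable K
    K≠∅ = let k , k∈K , _ = u∈′ in k , k∈K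

    hull₁ : Pred (Graph.V G) 0ℓ
    hull₁ = JoinUnion G u K

    hull₁⊆ : hull₁ ⊆ MetricShadow
    hull₁⊆ = JoinUnion⊆MetricShadow u∈′ K-convex K≠∅ id K⊆MetricShadow

    hull₂⊆ : JoinUnion G v hull₁ ⊆ MetricShadow
    hull₂⊆ = JoinUnion⊆MetricShadow (Shadow⇒MetricShadow v∈) (JoinUnion-convex K-convex K≠∅)
                                    (u , start∈JoinUnion K≠∅) ⊆JoinUnion hull₁⊆
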